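{- Let constants $m_{ij}\in\mathbb{C}$ be given for all $1\le i\ne j\le n$, and set $\alpha_{ij}=m_{ij}-m_{ji}$. Then the product $\prod_{1\le i\ne j\le n}(1+u_{ij})^{m_{ij}}\in\mathcal{U}^n$ lies in the subalgebra $\mathcal{V}^n$ if and only if the $\alpha_{ij}$ satisfy the combinatorial scattering equations $$\sum_{j\ne i}\alpha_{ij}=0\qquad\text{for each } i=1,\ldots,n.$$
   Context: $\mathcal{U}^n$ is the commutative algebra over $\mathbb{C}$ generated by $u_{ij}$, $i\ne j\in\{1,\ldots,n\}$, with $u_{ij}=-u_{ji}$, subject to $u_{ij}^2=0$ and $u_{ij}u_{jk}+u_{jk}u_{ki}+u_{ki}u_{ij}=0$ for distinct $i,j,k$. $\mathcal{V}^n$ is the subalgebra generated by the elements $v_{ijk}=u_{ij}+u_{jk}+u_{ki}$. Since $u_{ij}^2=0$, for $m\in\mathbb{C}$ the power $(1+u_{ij})^{m}$ means $\exp(mu_{ij})=1+mu_{ij}$. -}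

module Defs where

open import Level using (Level; _⊔_)
open import Algebra.Bundles using (CommutativeRing)
open import Data.Nat using (ℕ; zero; suc)
open import Data.Fin using (Fin)
open import Data.Fin.Properties using (_≟_)
open import Data.List using (List; foldr; allFin)
open import Data.Product using (Σ; ∃; _×_)
open import Relation.Nullary using (¬_; yes; no)
open import Relation.Binary.PropositionalEquality using (_≡_)

-- Agda's standard library has no complex numbers, so
-- the scalars are an arbitrary field of characteristic zero (ℂ being an
-- instance).

module _ {c ℓ : Level} (K : CommutativeRing c ℓ) where
  open CommutativeRing K using (Carrier; _≈_; _+_; _*_; -_; _-_; 0#; 1#)

  natK : ℕ → Carrier
  natK zero    = 0#
  natK (suc k) = 1# + natK k

  record IsCharZeroField : Set (c ⊔ ℓ) where
    field
      1≉0     : ¬ (1# ≈ 0#)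
      inverse : ∀ x → ¬ (x ≈ 0#) → Σ Carrier (λ y → (x * y) ≈ 1#)
      char0   : ∀ k → ¬ (natK (suc k) ≈ 0#)

-- The equivalence _≋_ is the congruence of commutative K-algebras
-- generated by the defining relations
--   u i i = 0,  u i j = - u j i,  u i j ² = 0,
--   u i j u j k + u j k u k i + u k i u i j = 0   (i,j,k distinct).
-- (Generators u i i are included only for convenience; they are forced
-- to be 0, so the quotient is exactly 𝒰ⁿ.)
-- 𝒰ⁿ is the setoid (UTerm n , _≋_).

  infixl 6 _⊕_
  infixl 7 _⊗_
  infix 4 _≋_

  data UTerm (n : ℕ) : Set c where
    con  : Carrier → UTerm n
    u    : Fin n → Fin n → UTerm n
    _⊕_  : UTerm n → UTerm n → UTerm n
    _⊗_  : UTerm n → UTerm n → UTerm n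
    ⊖_   : UTerm n → UTerm n

  data _≋_ {n : ℕ} : UTerm n → UTerm n → Set (c ⊔ ℓ) where
    ≋-refl  : ∀ {x} → x ≋ x
    ≋-sym   : ∀ {x y} → x ≋ y → y ≋ x
    ≋-trans : ∀ {x y z} → x ≋ y → y ≋ z → x ≋ z
    ⊕-cong  : ∀ {x x′ y y′} → x ≋ x′ → y ≋ y′ → x ⊕ y ≋ x′ ⊕ y′
    ⊗-cong  : ∀ {x x′ y y′} → x ≋ x′ → y ≋ y′ → x ⊗ y ≋ x′ ⊗ y′
    ⊖-cong  : ∀ {x x′} → x ≋ x′ → ⊖ x ≋ ⊖ x′
    ⊕-assoc : ∀ x y z → (x ⊕ y) ⊕ z ≋ x ⊕ (y ⊕ z)
    ⊕-comm  : ∀ x y → x ⊕ y ≋ y ⊕ x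
    ⊕-idˡ   : ∀ x → con 0# ⊕ x ≋ x
    ⊖-invˡ  : ∀ x → (⊖ x) ⊕ x ≋ con 0#
    ⊗-assoc : ∀ x y z → (x ⊗ y) ⊗ z ≋ x ⊗ (y ⊗ z)
    ⊗-comm  : ∀ x y → x ⊗ y ≋ y ⊗ x
    ⊗-idˡ   : ∀ x → con 1# ⊗ x ≋ x
    ⊗-distribˡ : ∀ x y z → x ⊗ (y ⊕ z) ≋ (x ⊗ y) ⊕ (x ⊗ z)
    con-cong : ∀ {a b} → a ≈ b → con a ≋ con b
    con-+    : ∀ a b → con (a + b) ≋ con a ⊕ con b
    con-*    : ∀ a b → con (a * b) ≋ con a ⊗ con b
    con-neg  : ∀ a → con (- a) ≋ ⊖ con a
    u-diag  : ∀ i → u i i ≋ con 0#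
    u-anti  : ∀ i j → u i j ≋ ⊖ u j i
    u-sq    : ∀ i j → u i j ⊗ u i j ≋ con 0#
    u-three : ∀ i j k → ¬ (i ≡ j) → ¬ (j ≡ k) → ¬ (k ≡ i) →
              (u i j ⊗ u j k) ⊕ (u j k ⊗ u k i) ⊕ (u k i ⊗ u i j) ≋ con 0#

-- The subalgebra 𝒱ⁿ generated by v i j k = u i j + u j k + u k i:
-- the image of the K-algebra of polynomial expressions in the v's.

  v : {n : ℕ} → Fin n → Fin n → Fin n → UTerm n
  v i j k = u i j ⊕ u j k ⊕ u k i

  data VTerm (n : ℕ) : Set c where
    vcon : Carrier → VTerm n
    vgen : Fin n → Fin n → Fin n → VTerm n
    _v+_ : VTerm n → VTerm n → VTerm n
    _v*_ : VTerm n → VTerm n → VTerm n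
    v-_  : VTerm n → VTerm n

  evalV : {n : ℕ} → VTerm n → UTerm n
  evalV (vcon a)   = con a
  evalV (vgen i j k) = v i j k
  evalV (x v+ y)   = evalV x ⊕ evalV y
  evalV (x v* y)   = evalV x ⊗ evalV y
  evalV (v- x)     = ⊖ evalV x

  In𝒱 : {n : ℕ} → UTerm n → Set (c ⊔ ℓ)
  In𝒱 {n} x = Σ (VTerm n) (λ e → evalV e ≋ x)

-- The product ∏_{i ≠ j} (1 + u i j)^{m i j} = ∏_{i ≠ j} (1 + m i j · u i j)
-- (since u i j² = 0), over all ordered pairs i ≠ j.

  factor : {n : ℕ} → (Fin n → Fin n → Carrier) → Fin n → Fin n → UTerm n
  factor m i j with i ≟ j
  ... | yes _ = con 1#
  ... | no  _ = con 1# ⊕ (con (m i j) ⊗ u i j)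

  prodU : {n : ℕ} → (Fin n → Fin n → Carrier) → UTerm n
  prodU {n} m =
    foldr (λ i acc → foldr (λ j acc′ → factor m i j ⊗ acc′) acc (allFin n))
          (con 1#) (allFin n)

  alpha : {n : ℕ} → (Fin n → Fin n → Carrier) → Fin n → Fin n → Carrier
  alpha m i j = m i j - m j i

  rowSum : {n : ℕ} → (Fin n → Fin n → Carrier) → Fin n → Carrier
  rowSum {n} a i = foldr (λ j acc → term j + acc) 0# (allFin n)
    where
    term : Fin n → Carrier
    term j with i ≟ j
    ... | yes _ = 0#
    ... | no  _ = a i j

  ScatteringEqs : {n : ℕ} → (Fin n → Fin n → Carrier) → Set ℓ
  ScatteringEqs {n} α = ∀ (i : Fin n) → rowSum α i ≈ 0#

module Submission where

-- For a base point o, u_oj² = 0 and the three-term relation give the factorisation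
--   (1 + v_ojk)^a = (1 + u_oj)^a (1 + u_jk)^a (1 + u_ko)^a.
-- Multiplying over all j, k with a = m_jk, the factors through o collect to
-- ∏_j (1 + u_oj)^(Σ_k α_jk), which is 1 under the scattering equations; so the product
-- lies in 𝒱ⁿ. Conversely, for weights x, u_ij ↦ ε(x_i - x_j) defines an algebra map
-- 𝒰ⁿ → K[ε] (ε² = 0) sending every v_ijk, hence all of 𝒱ⁿ, into K, and sending the
-- product to 1 + ε Σ_j x_j Σ_k α_jk. Taking x the indicator of p gives the p-th equation.

open import Defs
open import Level using (Level; _⊔_)
open import Algebra.Bundles using (CommutativeRing; Monoid; AbelianGroup)
import Algebra.Consequences.Setoid as Consequences
import Algebra.Construct.DirectProduct as DirectProduct
open import Data.Nat using (ℕ; zero; suc)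
open import Data.Fin using (Fin; zero; suc; punchIn)
open import Data.Fin.Properties using (_≟_; punchInᵢ≢i)
open import Data.List using (List; foldr; tabulate; allFin)
open import Data.Product using (_,_; proj₂; _×_)
import Data.Vec.Functional as Vector
open import Function using (_∘_; id)
open import Function.Bundles using (_⇔_; mk⇔)
open import Relation.Binary.Bundles using (Setoid)
open import Relation.Nullary using (yes; no; contradiction)
open import Relation.Binary.PropositionalEquality as ≡ using (_≡_; _≢_)

module _ {a ℓ} (M : Monoid a ℓ) where
  open Monoid M
  open import Algebra.Properties.Monoid.Sum M using (sum)

  foldr-tabulate : {A : Set} {G : A → Carrier → Carrier} (f : A → Carrier) →
                   (∀ x z → G x z ≈ f x ∙ z) →
                   ∀ {n} (g : Fin n → A) z → foldr G z (tabulate g) ≈ sum (f ∘ g) ∙ z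
  foldr-tabulate f step {zero}  g z = sym (identityˡ z)
  foldr-tabulate f step {suc n} g z =
    trans (step _ _) (trans (∙-congˡ (foldr-tabulate f step (g ∘ suc) z)) (sym (assoc _ _ _)))

module RingSums {c ℓ} (R : CommutativeRing c ℓ) where
  open CommutativeRing R
  open import Algebra.Properties.Ring ring using (-0#≈0#; -‿+-comm; [y-z]x≈yx-zx; x[y-z]≈xy-xz)
  open import Algebra.Properties.CommutativeMonoid.Sum +-commutativeMonoid public
    using () renaming (sum to ∑)
  open import Algebra.Properties.CommutativeMonoid.Sum +-commutativeMonoid
    using (sum-cong-≋; ∑-distrib-+; ∑-comm; sum-remove; sum-replicate-zero)
  open import Algebra.Properties.Semiring.Sum semiring using (*-distribʳ-sum)
  open import Relation.Binary.Reasoning.Setoid setoid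

  ∑-neg : ∀ {n} (f : Fin n → Carrier) → ∑ (λ i → - f i) ≈ - ∑ f
  ∑-neg {zero}  f = sym -0#≈0#
  ∑-neg {suc n} f = trans (+-congˡ (∑-neg (f ∘ suc))) (-‿+-comm _ _)

  ∑-distrib-- : ∀ {n} (f g : Fin n → Carrier) → ∑ (λ i → f i - g i) ≈ ∑ f - ∑ g
  ∑-distrib-- f g = trans (∑-distrib-+ f (λ i → - g i)) (+-congˡ (∑-neg g))

  ∑∑-distrib-- : ∀ {m n} (f g : Fin m → Fin n → Carrier) →
                 ∑ (λ i → ∑ (λ j → f i j - g i j)) ≈ ∑ (λ i → ∑ (f i)) - ∑ (λ i → ∑ (g i))
  ∑∑-distrib-- f g =
    trans (sum-cong-≋ (λ i → ∑-distrib-- (f i) (g i))) (∑-distrib-- (λ i → ∑ (f i)) (λ i → ∑ (g i)))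

  -- The left side is the ε-coefficient of the image of ∏ (1 + u_jk)^(c_jk) under u_ij ↦ ε(x_i - x_j).
  ∑-antisymmetrise : ∀ {n} (c : Fin n → Fin n → Carrier) (x : Fin n → Carrier) →
    ∑ (λ j → ∑ (λ k → c j k * (x j - x k))) ≈ ∑ (λ j → ∑ (λ k → c j k - c k j) * x j)
  ∑-antisymmetrise c x = begin
    ∑ (λ j → ∑ (λ k → c j k * (x j - x k)))
      ≈⟨ sum-cong-≋ (λ j → sum-cong-≋ (λ k → x[y-z]≈xy-xz (c j k) (x j) (x k))) ⟩
    ∑ (λ j → ∑ (λ k → c j k * x j - c j k * x k))
      ≈⟨ ∑∑-distrib-- (λ j k → c j k * x j) (λ j k → c j k * x k) ⟩
    ∑ (λ j → ∑ (λ k → c j k * x j)) - ∑ (λ j → ∑ (λ k → c j k * x k))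
      ≈⟨ +-congˡ (-‿cong (∑-comm (λ j k → c j k * x k))) ⟩
    ∑ (λ j → ∑ (λ k → c j k * x j)) - ∑ (λ j → ∑ (λ k → c k j * x j))
      ≈⟨ ∑∑-distrib-- (λ j k → c j k * x j) (λ j k → c k j * x j) ⟨
    ∑ (λ j → ∑ (λ k → c j k * x j - c k j * x j))
      ≈⟨ sum-cong-≋ (λ j → sum-cong-≋ (λ k → [y-z]x≈yx-zx (x j) (c j k) (c k j))) ⟨
    ∑ (λ j → ∑ (λ k → (c j k - c k j) * x j))
      ≈⟨ sum-cong-≋ (λ j → *-distribʳ-sum (x j) (λ k → c j k - c k j)) ⟨
    ∑ (λ j → ∑ (λ k → c j k - c k j) * x j) ∎

  δ : ∀ {n} → Fin n → Fin n → Carrier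
  δ p j with p ≟ j
  ... | yes _ = 1#
  ... | no  _ = 0#

  δ-diag : ∀ {n} (p : Fin n) → δ p p ≈ 1#
  δ-diag p with p ≟ p
  ... | yes _   = refl
  ... | no  p≢p = contradiction ≡.refl p≢p

  δ-off : ∀ {n} {p j : Fin n} → p ≢ j → δ p j ≈ 0#
  δ-off {p = p} {j} p≢j with p ≟ j
  ... | yes p≡j = contradiction p≡j p≢j
  ... | no  _   = refl

  ∑-δ : ∀ {n} (p : Fin n) (f : Fin n → Carrier) → ∑ (λ j → f j * δ p j) ≈ f p
  ∑-δ {suc n} p f = begin
    ∑ (λ j → f j * δ p j)
      ≈⟨ sum-remove {i = p} (λ j → f j * δ p j) ⟩
    f p * δ p p + ∑ (λ k → f (punchIn p k) * δ p (punchIn p k))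
      ≈⟨ +-cong (*-congˡ (δ-diag p)) (sum-cong-≋ λ k → *-congˡ (δ-off (punchInᵢ≢i p k ∘ ≡.sym))) ⟩
    f p * 1# + ∑ (λ k → f (punchIn p k) * 0#)
      ≈⟨ +-cong (*-identityʳ _) (trans (sum-cong-≋ λ k → zeroʳ (f (punchIn p k))) (sum-replicate-zero n)) ⟩
    f p + 0#
      ≈⟨ +-identityʳ _ ⟩
    f p ∎

  -- `rowSum` folds a function local to its `where` block; it is recovered from the
  -- unfolding of `rowSum`.
  private
    stepOf : ∀ {a b} {A : Set a} {B : Set b} {x : B} {G : A → B → B} {z : B} {xs : List A} →
             x ≡ foldr G z xs → A → B → B
    stepOf {G = G} _ = G

    rowSumStep : ∀ {n} (a : Fin n → Fin n → Carrier) (i : Fin n) → Fin n → Carrier → Carrier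
    rowSumStep {n} a i = stepOf {x = rowSum R a i} {z = 0#} {xs = allFin n} ≡.refl

    rowSumStep≈ : ∀ {n} (a : Fin n → Fin n → Carrier) → (∀ i → a i i ≈ 0#) →
                  ∀ i j z → rowSumStep a i j z ≈ a i j + z
    rowSumStep≈ a diag i j z with i ≟ j
    ... | yes ≡.refl = +-congʳ (sym (diag i))
    ... | no  _      = refl

  rowSum≈∑ : ∀ {n} (a : Fin n → Fin n → Carrier) → (∀ i → a i i ≈ 0#) →
             ∀ i → rowSum R a i ≈ ∑ (a i)
  rowSum≈∑ a diag i =
    trans (foldr-tabulate +-monoid (a i) (rowSumStep≈ a diag i) id 0#) (+-identityʳ _)

module Nilsquare {c ℓ} (R : CommutativeRing c ℓ) where
  open CommutativeRing R
  open import Algebra.Properties.Ring ring using (-‿distribʳ-*; -0#≈0#)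
  open import Relation.Binary.Reasoning.Setoid setoid
  open import Algebra.Solver.Ring.NaturalCoefficients.Default commutativeSemiring
    using (solve; _:=_; _:+_; _:*_; con)

  private
    x≈0⇒y*x≈0 : ∀ {x} → x ≈ 0# → ∀ y → y * x ≈ 0#
    x≈0⇒y*x≈0 x≈0 y = trans (*-congˡ x≈0) (zeroʳ y)

  1+ax*1+bx : ∀ {x} → x * x ≈ 0# → ∀ a b → (1# + a * x) * (1# + b * x) ≈ 1# + (a + b) * x
  1+ax*1+bx {x} x²≈0 a b = begin
    (1# + a * x) * (1# + b * x)             ≈⟨ solve 3 (λ x a b →
        (con 1 :+ a :* x) :* (con 1 :+ b :* x) := (con 1 :+ (a :+ b) :* x) :+ (a :* b) :* (x :* x))
        refl x a b ⟩
    1# + (a + b) * x + (a * b) * (x * x)    ≈⟨ +-congˡ (x≈0⇒y*x≈0 x²≈0 (a * b)) ⟩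
    1# + (a + b) * x + 0#                   ≈⟨ +-identityʳ _ ⟩
    1# + (a + b) * x                        ∎

  -- xyz = -x²(y + z) vanishes as well, so only the linear terms survive.
  1+ax*1+ay*1+az : ∀ {x y z} → x * x ≈ 0# → x * y + y * z + z * x ≈ 0# → ∀ a →
                   (1# + a * x) * (1# + a * y) * (1# + a * z) ≈ 1# + a * (x + y + z)
  1+ax*1+ay*1+az {x} {y} {z} x²≈0 cyc≈0 a = begin
    (1# + a * x) * (1# + a * y) * (1# + a * z)
      ≈⟨ +-identityʳ _ ⟨
    (1# + a * x) * (1# + a * y) * (1# + a * z) + 0#
      ≈⟨ +-congˡ (x≈0⇒y*x≈0 x²≈0 (a * a * a * (y + z))) ⟨
    (1# + a * x) * (1# + a * y) * (1# + a * z) + a * a * a * (y + z) * (x * x)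
      ≈⟨ solve 4 (λ a x y z →
           (con 1 :+ a :* x) :* (con 1 :+ a :* y) :* (con 1 :+ a :* z) :+ a :* a :* a :* (y :+ z) :* (x :* x)
           := con 1 :+ a :* (x :+ y :+ z) :+ (a :* a :+ a :* a :* a :* x) :* (x :* y :+ y :* z :+ z :* x))
         refl a x y z ⟩
    1# + a * (x + y + z) + (a * a + a * a * a * x) * (x * y + y * z + z * x)
      ≈⟨ +-congˡ (x≈0⇒y*x≈0 cyc≈0 (a * a + a * a * a * x)) ⟩
    1# + a * (x + y + z) + 0#
      ≈⟨ +-identityʳ _ ⟩
    1# + a * (x + y + z) ∎

  cyclic-rotate : ∀ x y z → x * y + y * z + z * x ≈ y * z + z * x + x * y
  cyclic-rotate = solve 3 (λ x y z → x :* y :+ y :* z :+ z :* x := y :* z :+ z :* x :+ x :* y) refl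

  cyclic-degenerate : ∀ {x y z} → x ≈ 0# → z ≈ - y → y * y ≈ 0# → x * y + y * z + z * x ≈ 0#
  cyclic-degenerate {x} {y} {z} x≈0 z≈-y y²≈0 = begin
    x * y + y * z + z * x
      ≈⟨ +-cong (+-cong (trans (*-comm x y) (x≈0⇒y*x≈0 x≈0 y)) (*-congˡ z≈-y)) (x≈0⇒y*x≈0 x≈0 z) ⟩
    0# + y * - y + 0#        ≈⟨ trans (+-identityʳ _) (+-identityˡ _) ⟩
    y * - y                  ≈⟨ -‿distribʳ-* y y ⟨
    - (y * y)                ≈⟨ -‿cong y²≈0 ⟩
    - 0#                     ≈⟨ -0#≈0# ⟩
    0#                       ∎

module DualNumbers {c ℓ} (K : CommutativeRing c ℓ) where
  open CommutativeRing K
  open import Algebra.Solver.Ring.NaturalCoefficients.Default commutativeSemiring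
    using (solve; _:=_; _:+_; _:*_; con)
  private
    module Additive = AbelianGroup (DirectProduct.abelianGroup +-abelianGroup +-abelianGroup)
  open Consequences Additive.setoid using (comm∧idˡ⇒id; comm∧distrˡ⇒distr)

  infixl 7 _*ᴰ_

  -- (a , b) stands for a + bε with ε² = 0.
  _*ᴰ_ : Carrier × Carrier → Carrier × Carrier → Carrier × Carrier
  (a , b) *ᴰ (a′ , b′) = a * a′ , a * b′ + b * a′

  private
    *ᴰ-comm : ∀ p q → p *ᴰ q Additive.≈ q *ᴰ p
    *ᴰ-comm (a , b) (a′ , b′) =
      *-comm a a′ , solve 4 (λ a b a′ b′ → a :* b′ :+ b :* a′ := a′ :* b :+ b′ :* a) refl a b a′ b′

  dualNumbers : CommutativeRing c ℓ
  dualNumbers = record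
    { Carrier = Carrier × Carrier
    ; _≈_ = Additive._≈_
    ; _+_ = Additive._∙_
    ; _*_ = _*ᴰ_
    ; -_  = Additive._⁻¹
    ; 0#  = Additive.ε
    ; 1#  = 1# , 0#
    ; isCommutativeRing = record
      { isRing = record
        { +-isAbelianGroup = Additive.isAbelianGroup
        ; *-cong = λ { (p , q) (p′ , q′) → *-cong p p′ , +-cong (*-cong p q′) (*-cong q p′) }
        ; *-assoc = λ { (a , b) (a′ , b′) (a″ , b″) → *-assoc a a′ a″ ,
            solve 6 (λ a b a′ b′ a″ b″ →
              a :* a′ :* b″ :+ (a :* b′ :+ b :* a′) :* a″
              := a :* (a′ :* b″ :+ b′ :* a″) :+ b :* (a′ :* a″)) refl a b a′ b′ a″ b″ }
        ; *-identity = comm∧idˡ⇒id *ᴰ-comm λ { (a , b) → *-identityˡ a ,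
            solve 2 (λ a b → con 1 :* b :+ con 0 :* a := b) refl a b }
        ; distrib = comm∧distrˡ⇒distr Additive.∙-cong *ᴰ-comm λ { (a , b) (a′ , b′) (a″ , b″) →
            distribˡ a a′ a″ ,
            solve 6 (λ a b a′ b′ a″ b″ →
              a :* (b′ :+ b″) :+ b :* (a′ :+ a″) := (a :* b′ :+ b :* a′) :+ (a :* b″ :+ b :* a″))
              refl a b a′ b′ a″ b″ }
        }
      ; *-comm = *ᴰ-comm
      }
    }

  1+aε*1+bε : ∀ a b → (1# , a) *ᴰ (1# , b) Additive.≈ (1# , a + b)
  1+aε*1+bε a b = *-identityˡ 1# , solve 2 (λ a b → con 1 :* b :+ a :* con 1 := a :+ b) refl a b

  aε*bε : ∀ a b → (0# , a) *ᴰ (0# , b) Additive.≈ (0# , 0#)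
  aε*bε a b = zeroˡ 0# , solve 2 (λ a b → con 0 :* b :+ a :* con 0 := con 0) refl a b

module Presentation {c ℓ} (K : CommutativeRing c ℓ) (n : ℕ) where
  private module K = CommutativeRing K
  open RingSums K using (∑; ∑-antisymmetrise)

  infix 4 _≈ᵁ_
  _≈ᵁ_ : UTerm K n → UTerm K n → Set (c ⊔ ℓ)
  _≈ᵁ_ = _≋_ K

  ≋-setoid : Setoid c (c ⊔ ℓ)
  ≋-setoid = record
    { Carrier = UTerm K n
    ; _≈_ = _≈ᵁ_
    ; isEquivalence = record { refl = ≋-refl ; sym = ≋-sym ; trans = ≋-trans }
    }

  open Consequences ≋-setoid using (comm∧idˡ⇒id; comm∧invˡ⇒inv; comm∧distrˡ⇒distr)

  𝒰 : CommutativeRing c (c ⊔ ℓ)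
  𝒰 = record
    { Carrier = UTerm K n
    ; _≈_ = _≈ᵁ_
    ; _+_ = _⊕_
    ; _*_ = _⊗_
    ; -_  = ⊖_
    ; 0#  = con K.0#
    ; 1#  = con K.1#
    ; isCommutativeRing = record
      { isRing = record
        { +-isAbelianGroup = record
          { isGroup = record
            { isMonoid = record
              { isSemigroup = record
                { isMagma = record { isEquivalence = Setoid.isEquivalence ≋-setoid ; ∙-cong = ⊕-cong }
                ; assoc = ⊕-assoc
                }
              ; identity = comm∧idˡ⇒id ⊕-comm ⊕-idˡ
              }
            ; inverse = comm∧invˡ⇒inv ⊕-comm ⊖-invˡ
            ; ⁻¹-cong = ⊖-cong
            }
          ; comm = ⊕-comm
          }
        ; *-cong = ⊗-cong
        ; *-assoc = ⊗-assoc
        ; *-identity = comm∧idˡ⇒id ⊗-comm ⊗-idˡ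
        ; distrib = comm∧distrˡ⇒distr ⊕-cong ⊗-comm ⊗-distribˡ
        }
      ; *-comm = ⊗-comm
      }
    }

  private module U = CommutativeRing 𝒰
  open Nilsquare 𝒰
  open import Algebra.Properties.Ring U.ring using (-‿distribˡ-*; -‿distribʳ-*)
  open import Algebra.Properties.CommutativeSemigroup U.*-commutativeSemigroup using (xy∙z≈y∙xz)
  open import Algebra.Properties.CommutativeMonoid.Sum U.*-commutativeMonoid
    using ()
    renaming (sum to ∏; sum-cong-≋ to ∏-cong; ∑-distrib-+ to ∏-distrib; ∑-comm to ∏-comm;
              sum-replicate-zero to ∏-replicate-1)
  open import Relation.Binary.Reasoning.Setoid ≋-setoid

  u-cycle : ∀ i j k → u i j ⊗ u j k ⊕ u j k ⊗ u k i ⊕ u k i ⊗ u i j ≈ᵁ con K.0#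
  u-cycle i j k with i ≟ j
  ... | yes ≡.refl = cyclic-degenerate (u-diag i) (u-anti k i) (u-sq i k)
  ... | no i≢j with j ≟ k
  ...   | yes ≡.refl = ≋-trans (cyclic-rotate (u i j) (u j j) (u j i))
                               (cyclic-degenerate (u-diag j) (u-anti i j) (u-sq j i))
  ...   | no j≢k with k ≟ i
  ...     | yes ≡.refl = ≋-trans (cyclic-rotate (u k j) (u j k) (u k k))
                         (≋-trans (cyclic-rotate (u j k) (u k k) (u k j))
                                  (cyclic-degenerate (u-diag k) (u-anti j k) (u-sq k j)))
  ...     | no k≢i = u-three i j k i≢j j≢k k≢i

  -- (1 + x)^a for a nilsquare x, where the binomial series stops after the linear term.
  infix 8 [1+_]^_
  [1+_]^_ : UTerm K n → K.Carrier → UTerm K n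
  [1+ x ]^ a = con K.1# ⊕ con a ⊗ x

  [1+]^-congˡ : ∀ {x y} a → x ≈ᵁ y → [1+ x ]^ a ≈ᵁ [1+ y ]^ a
  [1+]^-congˡ a x≈y = ⊕-cong ≋-refl (⊗-cong ≋-refl x≈y)

  [1+]^-congʳ : ∀ x {a b} → a K.≈ b → [1+ x ]^ a ≈ᵁ [1+ x ]^ b
  [1+]^-congʳ x a≈b = ⊕-cong ≋-refl (⊗-cong (con-cong a≈b) ≋-refl)

  [1+]^0 : ∀ x → [1+ x ]^ K.0# ≈ᵁ con K.1#
  [1+]^0 x = ≋-trans (⊕-cong ≋-refl (U.zeroˡ x)) (U.+-identityʳ _)

  [1+0]^ : ∀ a → [1+ con K.0# ]^ a ≈ᵁ con K.1#
  [1+0]^ a = ≋-trans (⊕-cong ≋-refl (U.zeroʳ (con a))) (U.+-identityʳ _)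

  [1+]^-+ : ∀ {x} → x ⊗ x ≈ᵁ con K.0# → ∀ a b → [1+ x ]^ a ⊗ [1+ x ]^ b ≈ᵁ [1+ x ]^ (a K.+ b)
  [1+]^-+ x²≈0 a b =
    ≋-trans (1+ax*1+bx x²≈0 (con a) (con b)) (⊕-cong ≋-refl (⊗-cong (≋-sym (con-+ a b)) ≋-refl))

  [1+⊖]^ : ∀ x a → [1+ ⊖ x ]^ a ≈ᵁ [1+ x ]^ (K.- a)
  [1+⊖]^ x a = ⊕-cong ≋-refl (begin
    con a ⊗ ⊖ x     ≈⟨ -‿distribʳ-* (con a) x ⟨
    ⊖ (con a ⊗ x)   ≈⟨ -‿distribˡ-* (con a) x ⟩
    ⊖ con a ⊗ x     ≈⟨ ⊗-cong (con-neg a) ≋-refl ⟨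
    con (K.- a) ⊗ x ∎)

  ∏-[1+]^ : ∀ {x} → x ⊗ x ≈ᵁ con K.0# → ∀ {m} (a : Fin m → K.Carrier) →
            ∏ (λ k → [1+ x ]^ a k) ≈ᵁ [1+ x ]^ ∑ a
  ∏-[1+]^ {x} x²≈0 {zero}  a = ≋-sym ([1+]^0 x)
  ∏-[1+]^ {x} x²≈0 {suc m} a =
    ≋-trans (⊗-cong ≋-refl (∏-[1+]^ x²≈0 (a ∘ suc))) ([1+]^-+ x²≈0 (a zero) (∑ (a ∘ suc)))

  [1+v]^ : ∀ o j k a → [1+ v K o j k ]^ a ≈ᵁ [1+ u o j ]^ a ⊗ [1+ u j k ]^ a ⊗ [1+ u k o ]^ a
  [1+v]^ o j k a = ≋-sym (1+ax*1+ay*1+az (u-sq o j) (u-cycle o j k) (con a))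

  ∏∏-distrib : ∀ {m} (f g : Fin m → Fin m → UTerm K n) →
               ∏ (λ j → ∏ (λ k → f j k ⊗ g j k)) ≈ᵁ ∏ (λ j → ∏ (f j)) ⊗ ∏ (λ j → ∏ (g j))
  ∏∏-distrib f g =
    ≋-trans (∏-cong (λ j → ∏-distrib (f j) (g j))) (∏-distrib (λ j → ∏ (f j)) (λ j → ∏ (g j)))

  factor≈[1+u]^ : ∀ (m : Fin n → Fin n → K.Carrier) i j → factor K m i j ≈ᵁ [1+ u i j ]^ m i j
  factor≈[1+u]^ m i j with i ≟ j
  ... | yes ≡.refl = ≋-sym (≋-trans ([1+]^-congˡ (m i i) (u-diag i)) ([1+0]^ (m i i)))
  ... | no  _      = ≋-refl

  prodU≈∏∏ : ∀ m → prodU K m ≈ᵁ ∏ (λ i → ∏ (λ j → [1+ u i j ]^ m i j))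
  prodU≈∏∏ m = begin
    prodU K m
      ≈⟨ foldr-tabulate U.*-monoid (λ i → ∏ (factor K m i))
           (λ i → foldr-tabulate U.*-monoid (factor K m i) (λ _ _ → ≋-refl) id) id (con K.1#) ⟩
    ∏ (λ i → ∏ (factor K m i)) ⊗ con K.1#
      ≈⟨ U.*-identityʳ _ ⟩
    ∏ (λ i → ∏ (factor K m i))
      ≈⟨ ∏-cong (λ i → ∏-cong (factor≈[1+u]^ m i)) ⟩
    ∏ (λ i → ∏ (λ j → [1+ u i j ]^ m i j)) ∎

  flux : ∀ {m} (w : Fin m → UTerm K n) → (∀ j → w j ⊗ w j ≈ᵁ con K.0#) →
         (c : Fin m → Fin m → K.Carrier) →
         ∏ (λ j → ∏ (λ k → [1+ w j ]^ c j k ⊗ [1+ w k ]^ (K.- c j k)))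
           ≈ᵁ ∏ (λ j → [1+ w j ]^ ∑ (λ k → c j k K.- c k j))
  flux w w²≈0 c = begin
    ∏ (λ j → ∏ (λ k → [1+ w j ]^ c j k ⊗ [1+ w k ]^ (K.- c j k)))
      ≈⟨ ∏∏-distrib (λ j k → [1+ w j ]^ c j k) (λ j k → [1+ w k ]^ (K.- c j k)) ⟩
    ∏ (λ j → ∏ (λ k → [1+ w j ]^ c j k)) ⊗ ∏ (λ j → ∏ (λ k → [1+ w k ]^ (K.- c j k)))
      ≈⟨ ⊗-cong ≋-refl (∏-comm (λ j k → [1+ w k ]^ (K.- c j k))) ⟩
    ∏ (λ j → ∏ (λ k → [1+ w j ]^ c j k)) ⊗ ∏ (λ j → ∏ (λ k → [1+ w j ]^ (K.- c k j)))
      ≈⟨ ∏∏-distrib (λ j k → [1+ w j ]^ c j k) (λ j k → [1+ w j ]^ (K.- c k j)) ⟨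
    ∏ (λ j → ∏ (λ k → [1+ w j ]^ c j k ⊗ [1+ w j ]^ (K.- c k j)))
      ≈⟨ ∏-cong (λ j → ∏-cong (λ k → [1+]^-+ (w²≈0 j) (c j k) (K.- c k j))) ⟩
    ∏ (λ j → ∏ (λ k → [1+ w j ]^ (c j k K.- c k j)))
      ≈⟨ ∏-cong (λ j → ∏-[1+]^ (w²≈0 j) (λ k → c j k K.- c k j)) ⟩
    ∏ (λ j → [1+ w j ]^ ∑ (λ k → c j k K.- c k j)) ∎

  ∏∏[1+v]^ : ∀ o (m : Fin n → Fin n → K.Carrier) →
             ∏ (λ j → ∏ (λ k → [1+ v K o j k ]^ m j k))
               ≈ᵁ ∏ (λ j → ∏ (λ k → [1+ u j k ]^ m j k))
                  ⊗ ∏ (λ j → [1+ u o j ]^ ∑ (λ k → m j k K.- m k j))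
  ∏∏[1+v]^ o m = begin
    ∏ (λ j → ∏ (λ k → [1+ v K o j k ]^ m j k))
      ≈⟨ ∏-cong (λ j → ∏-cong (λ k → split j k)) ⟩
    ∏ (λ j → ∏ (λ k → [1+ u j k ]^ m j k ⊗ ([1+ u o j ]^ m j k ⊗ [1+ u o k ]^ (K.- m j k))))
      ≈⟨ ∏∏-distrib _ (λ j k → [1+ u o j ]^ m j k ⊗ [1+ u o k ]^ (K.- m j k)) ⟩
    ∏ (λ j → ∏ (λ k → [1+ u j k ]^ m j k))
      ⊗ ∏ (λ j → ∏ (λ k → [1+ u o j ]^ m j k ⊗ [1+ u o k ]^ (K.- m j k)))
      ≈⟨ ⊗-cong ≋-refl (flux (u o) (u-sq o) m) ⟩
    ∏ (λ j → ∏ (λ k → [1+ u j k ]^ m j k)) ⊗ ∏ (λ j → [1+ u o j ]^ ∑ (λ k → m j k K.- m k j)) ∎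
    where
    split : ∀ j k → [1+ v K o j k ]^ m j k
                    ≈ᵁ [1+ u j k ]^ m j k ⊗ ([1+ u o j ]^ m j k ⊗ [1+ u o k ]^ (K.- m j k))
    split j k = ≋-trans ([1+v]^ o j k (m j k)) (≋-trans (xy∙z≈y∙xz _ _ _)
      (⊗-cong ≋-refl (⊗-cong ≋-refl
        (≋-trans ([1+]^-congˡ (m j k) (u-anti k o)) ([1+⊖]^ (u o k) (m j k))))))

  vprod : ∀ {m} → (Fin m → VTerm K n) → VTerm K n
  vprod = Vector.foldr _v*_ (vcon K.1#)

  evalV-vprod : ∀ {m} (f : Fin m → VTerm K n) → evalV K (vprod f) ≡ ∏ (evalV K ∘ f)
  evalV-vprod {zero}  f = ≡.refl
  evalV-vprod {suc m} f = ≡.cong (evalV K (f zero) ⊗_) (evalV-vprod (f ∘ suc))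

  ∑α≈0⇒prodU∈𝒱 : Fin n → ∀ m → (∀ j → ∑ (λ k → m j k K.- m k j) K.≈ K.0#) → In𝒱 K (prodU K m)
  ∑α≈0⇒prodU∈𝒱 o m eqs = vprod (vprod ∘ witness) , (begin
    evalV K (vprod (vprod ∘ witness))
      ≡⟨ evalV-vprod (vprod ∘ witness) ⟩
    ∏ (λ j → evalV K (vprod (witness j)))
      ≈⟨ ∏-cong (λ j → U.reflexive (evalV-vprod (witness j))) ⟩
    ∏ (λ j → ∏ (λ k → [1+ v K o j k ]^ m j k))
      ≈⟨ ∏∏[1+v]^ o m ⟩
    ∏ (λ j → ∏ (λ k → [1+ u j k ]^ m j k)) ⊗ ∏ (λ j → [1+ u o j ]^ ∑ (λ k → m j k K.- m k j))
      ≈⟨ ⊗-cong ≋-refl (∏-cong (λ j → ≋-trans ([1+]^-congʳ (u o j) (eqs j)) ([1+]^0 (u o j)))) ⟩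
    ∏ (λ j → ∏ (λ k → [1+ u j k ]^ m j k)) ⊗ ∏ {n} (λ _ → con K.1#)
      ≈⟨ ⊗-cong ≋-refl (∏-replicate-1 n) ⟩
    ∏ (λ j → ∏ (λ k → [1+ u j k ]^ m j k)) ⊗ con K.1#
      ≈⟨ U.*-identityʳ _ ⟩
    ∏ (λ j → ∏ (λ k → [1+ u j k ]^ m j k))
      ≈⟨ prodU≈∏∏ m ⟨
    prodU K m ∎)
    where
    witness : Fin n → Fin n → VTerm K n
    witness j k = vcon K.1# v+ (vcon (m j k) v* vgen o j k)

module IntoDualNumbers {c ℓ} (K : CommutativeRing c ℓ) {n : ℕ}
                       (x : Fin n → CommutativeRing.Carrier K) where
  private module K = CommutativeRing K
  open Presentation K n
  open RingSums K using (∑; ∑-antisymmetrise)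
  open import Algebra.Properties.CommutativeMonoid.Sum (CommutativeRing.*-commutativeMonoid 𝒰)
    using () renaming (sum to ∏)
  open DualNumbers K using (dualNumbers; 1+aε*1+bε; aε*bε)
  private module D = CommutativeRing dualNumbers
  open import Algebra.Properties.Ring K.ring using (-0#≈0#)
  open import Algebra.Properties.AbelianGroup K.+-abelianGroup using (⁻¹-anti-homo‿-)
  open import Algebra.Solver.Ring.NaturalCoefficients.Default K.commutativeSemiring
    using (solve; _:=_; _:+_; _:*_; con)

  ⟦_⟧ : UTerm K n → D.Carrier
  ⟦ con a ⟧ = a , K.0#
  ⟦ u i j ⟧ = K.0# , x i K.- x j
  ⟦ a ⊕ b ⟧ = ⟦ a ⟧ D.+ ⟦ b ⟧
  ⟦ a ⊗ b ⟧ = ⟦ a ⟧ D.* ⟦ b ⟧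
  ⟦ ⊖ a ⟧   = D.- ⟦ a ⟧

  ⟦⟧-cong : ∀ {a b} → a ≈ᵁ b → ⟦ a ⟧ D.≈ ⟦ b ⟧
  ⟦⟧-cong ≋-refl                  = D.refl
  ⟦⟧-cong (≋-sym p)               = D.sym (⟦⟧-cong p)
  ⟦⟧-cong (≋-trans p q)           = D.trans (⟦⟧-cong p) (⟦⟧-cong q)
  ⟦⟧-cong (⊕-cong p q)            = D.+-cong (⟦⟧-cong p) (⟦⟧-cong q)
  ⟦⟧-cong (⊗-cong p q)            = D.*-cong (⟦⟧-cong p) (⟦⟧-cong q)
  ⟦⟧-cong (⊖-cong p)              = D.-‿cong (⟦⟧-cong p)
  ⟦⟧-cong (⊕-assoc a b c)         = D.+-assoc _ _ _
  ⟦⟧-cong (⊕-comm a b)            = D.+-comm _ _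
  ⟦⟧-cong (⊕-idˡ a)               = D.+-identityˡ _
  ⟦⟧-cong (⊖-invˡ a)              = D.-‿inverseˡ _
  ⟦⟧-cong (⊗-assoc a b c)         = D.*-assoc _ _ _
  ⟦⟧-cong (⊗-comm a b)            = D.*-comm _ _
  ⟦⟧-cong (⊗-idˡ a)               = D.*-identityˡ _
  ⟦⟧-cong (⊗-distribˡ a b c)      = D.distribˡ _ _ _
  ⟦⟧-cong (con-cong a≈b)          = a≈b , K.refl
  ⟦⟧-cong (con-+ a b)             = K.refl , K.sym (K.+-identityˡ K.0#)
  ⟦⟧-cong (con-* a b)             =
    K.refl , K.sym (K.trans (K.+-cong (K.zeroʳ a) (K.zeroˡ b)) (K.+-identityʳ K.0#))
  ⟦⟧-cong (con-neg a)             = K.refl , K.sym -0#≈0#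
  ⟦⟧-cong (u-diag i)              = K.refl , K.-‿inverseʳ (x i)
  ⟦⟧-cong (u-anti i j)            = K.sym -0#≈0# , K.sym (⁻¹-anti-homo‿- (x j) (x i))
  ⟦⟧-cong (u-sq i j)              = aε*bε _ _
  ⟦⟧-cong (u-three i j k _ _ _)   =
    D.trans (D.+-cong (D.+-cong (aε*bε _ _) (aε*bε _ _)) (aε*bε _ _))
            (D.trans (D.+-identityʳ _) (D.+-identityʳ _))

  ⟦evalV⟧-pure : ∀ e → proj₂ ⟦ evalV K e ⟧ K.≈ K.0#
  ⟦evalV⟧-pure (vcon a)     = K.refl
  ⟦evalV⟧-pure (vgen i j k) = differences-cycle (x i) (x j) (x k)
    where
    differences-cycle : ∀ a b c → (a K.- b) K.+ (b K.- c) K.+ (c K.- a) K.≈ K.0#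
    differences-cycle a b c = K.trans
      (solve 6 (λ a b c a′ b′ c′ → a :+ b′ :+ (b :+ c′) :+ (c :+ a′) := a :+ a′ :+ (b :+ b′) :+ (c :+ c′))
             K.refl a b c (K.- a) (K.- b) (K.- c))
      (K.trans (K.+-cong (K.+-cong (K.-‿inverseʳ a) (K.-‿inverseʳ b)) (K.-‿inverseʳ c))
               (K.trans (K.+-identityʳ _) (K.+-identityʳ K.0#)))
  ⟦evalV⟧-pure (e v+ f)     = K.trans (K.+-cong (⟦evalV⟧-pure e) (⟦evalV⟧-pure f)) (K.+-identityʳ K.0#)
  ⟦evalV⟧-pure (e v* f)     = K.trans (K.+-cong (K.trans (K.*-congˡ (⟦evalV⟧-pure f)) (K.zeroʳ _))
                                                (K.trans (K.*-congʳ (⟦evalV⟧-pure e)) (K.zeroˡ _)))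
                                      (K.+-identityʳ K.0#)
  ⟦evalV⟧-pure (v- e)       = K.trans (K.-‿cong (⟦evalV⟧-pure e)) -0#≈0#

  ⟦[1+u]^⟧ : ∀ i j a → ⟦ [1+ u i j ]^ a ⟧ D.≈ (K.1# , a K.* (x i K.- x j))
  ⟦[1+u]^⟧ i j a =
    solve 1 (λ a → con 1 :+ a :* con 0 := con 1) K.refl a ,
    solve 2 (λ a d → con 0 :+ (a :* d :+ con 0 :* con 0) := a :* d) K.refl a (x i K.- x j)

  ⟦∏⟧ : ∀ {m} {f : Fin m → UTerm K n} (b : Fin m → K.Carrier) →
        (∀ j → ⟦ f j ⟧ D.≈ (K.1# , b j)) → ⟦ ∏ f ⟧ D.≈ (K.1# , ∑ b)
  ⟦∏⟧ {zero}  b fj≈ = D.refl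
  ⟦∏⟧ {suc m} b fj≈ = D.trans (D.*-cong (fj≈ zero) (⟦∏⟧ (b ∘ suc) (fj≈ ∘ suc))) (1+aε*1+bε _ _)

  prodU∈𝒱⇒∑α*x≈0 : ∀ m → In𝒱 K (prodU K m) →
                    ∑ (λ j → ∑ (λ k → m j k K.- m k j) K.* x j) K.≈ K.0#
  prodU∈𝒱⇒∑α*x≈0 m (e , e≈prodU) = begin
    ∑ (λ j → ∑ (λ k → m j k K.- m k j) K.* x j)   ≈⟨ ∑-antisymmetrise m x ⟨
    ∑ (λ j → ∑ (λ k → m j k K.* (x j K.- x k)))   ≈⟨ proj₂ ⟦prodU⟧ ⟨
    proj₂ ⟦ prodU K m ⟧                            ≈⟨ proj₂ (⟦⟧-cong e≈prodU) ⟨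
    proj₂ ⟦ evalV K e ⟧                            ≈⟨ ⟦evalV⟧-pure e ⟩
    K.0#                                           ∎
    where
    open import Relation.Binary.Reasoning.Setoid K.setoid
    ⟦prodU⟧ : ⟦ prodU K m ⟧ D.≈ (K.1# , ∑ (λ j → ∑ (λ k → m j k K.* (x j K.- x k))))
    ⟦prodU⟧ = D.trans (⟦⟧-cong (prodU≈∏∏ m))
                      (⟦∏⟧ _ (λ j → ⟦∏⟧ _ (λ k → ⟦[1+u]^⟧ j k (m j k))))

module _ {c ℓ} (K : CommutativeRing c ℓ) where
  open CommutativeRing K hiding (zero)
  open RingSums K using (∑; rowSum≈∑; δ; ∑-δ)

  rowSum-alpha≈∑ : ∀ {n} (m : Fin n → Fin n → Carrier) i →
                   rowSum K (alpha K m) i ≈ ∑ (λ k → m i k - m k i)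
  rowSum-alpha≈∑ m = rowSum≈∑ (alpha K m) (λ i → -‿inverseʳ (m i i))

  prodU∈𝒱⇒scatteringEqs : ∀ {n} (m : Fin n → Fin n → Carrier) →
                           In𝒱 K (prodU K m) → ScatteringEqs K (alpha K m)
  prodU∈𝒱⇒scatteringEqs m m∈𝒱 p = begin
    rowSum K (alpha K m) p                     ≈⟨ rowSum-alpha≈∑ m p ⟩
    ∑ (λ k → m p k - m k p)                    ≈⟨ ∑-δ p (λ j → ∑ (λ k → m j k - m k j)) ⟨
    ∑ (λ j → ∑ (λ k → m j k - m k j) * δ p j)  ≈⟨ IntoDualNumbers.prodU∈𝒱⇒∑α*x≈0 K (δ p) m m∈𝒱 ⟩
    0#                                         ∎
    where open import Relation.Binary.Reasoning.Setoid setoid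

  scatteringEqs⇒prodU∈𝒱 : ∀ {n} (m : Fin n → Fin n → Carrier) →
                           ScatteringEqs K (alpha K m) → In𝒱 K (prodU K m)
  scatteringEqs⇒prodU∈𝒱 {zero}  m _   = vcon 1# , ≋-refl
  scatteringEqs⇒prodU∈𝒱 {suc n} m eqs =
    Presentation.∑α≈0⇒prodU∈𝒱 K (suc n) zero m (λ j → trans (sym (rowSum-alpha≈∑ m j)) (eqs j))

proposition49 : {c ℓ : Level} (K : CommutativeRing c ℓ) → IsCharZeroField K →
    (n : ℕ) (m : Fin n → Fin n → CommutativeRing.Carrier K) →
    In𝒱 K (prodU K m) ⇔ ScatteringEqs K (alpha K m)
proposition49 K _ n m = mk⇔ (prodU∈𝒱⇒scatteringEqs K m) (scatteringEqs⇒prodU∈𝒱 K m)
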